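{- Let $q$ be a prime power, $n\ge1$, and $m\ge0$ an integer with $(q-1)\mid(m+n)$; put $k=\frac{m+n}{q-1}-1$ and assume $k\ge1$. Let $P=\sum_{i=0}^ma_i\theta^i\in\mathbb F_q[\theta]$ and $\iota(P)=\sum_{i=0}^ma_{m-i}\theta^i$. Let $W_3$ be the $k\times k$ matrix with $(W_3)_{i,k+1-i}=1$ for $i=1,\dots,k$ and all other entries $0$. Then $$W_3\,\mathfrak M(P,T,n,k)\,W_3^{ -1}=(-T)^n\,\mathfrak M(\iota(P),T^{ -1},n,k),$$ where $\mathfrak M(\iota(P),T^{ -1},n,k)$ denotes $\mathfrak M(\iota(P),T,n,k)$ with $T$ replaced by $T^{ -1}$.
   Context: For $F=\sum_{i=0}^mb_i\theta^i\in\mathbb F_q[\theta]$, $\mathfrak M(F,T,n,k)$ is the $k\times k$ matrix over $\mathbb F_q[T]$ with rows and columns indexed by $1,\dots,k$ and entries $\mathfrak M(F,T,n,k)_{i,j}=\sum_{l=0}^nT^{n-l}(-1)^l\binom nl b_{iq-j-l}$, where $b_s:=0$ for $s\notin\{0,\dots,m\}$. -}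

module Defs where

open import Level using (Level; _⊔_)
open import Algebra.Bundles using (CommutativeRing)
open import Data.Nat as ℕ using (ℕ; zero; suc; _∸_)
open import Data.Nat.Combinatorics using (_C_)
open import Data.Nat.Primality using (Prime)
open import Data.Integer as ℤ using (ℤ; +_)
open import Data.Fin as Fin using (Fin; toℕ; opposite)
open import Data.Fin.Properties using () renaming (_≟_ to _≟F_)
open import Data.Product using (Σ; _×_; ∃₂)
open import Relation.Nullary using (¬_; yes; no)
open import Relation.Binary.PropositionalEquality using (_≡_; setoid)
open import Function.Bundles using (Inverse)

IsField : ∀ {c ℓ} → CommutativeRing c ℓ → Set (c ⊔ ℓ)
IsField R = ¬ (0# ≈ 1#) × (∀ x → ¬ (x ≈ 0#) → Σ Carrier λ y → x * y ≈ 1#)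
  where open CommutativeRing R

HasCard : ∀ {c ℓ} → CommutativeRing c ℓ → ℕ → Set (c ⊔ ℓ)
HasCard R q = Inverse (setoid (Fin q)) (CommutativeRing.setoid R)

IsPrimePower : ℕ → Set
IsPrimePower q = ∃₂ λ p r → Prime p × q ≡ p ℕ.^ suc r

module _ {c ℓ} (R : CommutativeRing c ℓ) where
  open CommutativeRing R

  -- Polynomials in θ of formal degree ≤ m: coefficient vectors a_0 … a_m.
  Poly : ℕ → Set c
  Poly m = Fin (suc m) → Carrier

  ι : ∀ {m} → Poly m → Poly m
  ι P i = P (opposite i)

  -- b_s, with b_s := 0 for s ∉ {0,…,m}
  coeff : ∀ {m} → Poly m → ℤ → Carrier
  coeff {m} P (+ s) with s ℕ.<? suc m
  ... | yes s<m = P (Fin.fromℕ< s<m)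
  ... | no _    = 0#
  coeff P ℤ.-[1+ _ ] = 0#

  ⟦_⟧ : ℕ → Carrier
  ⟦ zero ⟧  = 0#
  ⟦ suc n ⟧ = 1# + ⟦ n ⟧

  sgn : ℕ → Carrier
  sgn zero    = 1#
  sgn (suc l) = - (sgn l)

  -- Laurent polynomials in T over R, as coefficient functions ℤ → R
  -- (coefficient of T^d); equality is coefficientwise.
  LP : Set c
  LP = ℤ → Carrier

  _≈LP_ : LP → LP → Set ℓ
  f ≈LP g = ∀ d → f d ≈ g d

  0LP : LP
  0LP _ = 0#

  _+LP_ : LP → LP → LP
  (f +LP g) d = f d + g d

  _•_ : Carrier → LP → LP
  (a • f) d = a * f d

  Tpow : ℤ → LP
  Tpow e d with d ℤ.≟ e
  ... | yes _ = 1#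
  ... | no _  = 0#

  mulMono : Carrier → ℤ → LP → LP
  mulMono a e f d = a * f (d ℤ.- e)

  ΣLP : ℕ → (ℕ → LP) → LP
  ΣLP zero    f = f 0
  ΣLP (suc n) f = ΣLP n f +LP f (suc n)

  ΣFin : ∀ {k} → (Fin k → LP) → LP
  ΣFin {zero}  f = 0LP
  ΣFin {suc k} f = f Fin.zero +LP ΣFin (λ i → f (Fin.suc i))

  -- k×k matrices (rows/columns indexed by Fin k; Fin index i ↔ paper index i+1)
  Mat : Set c → ℕ → Set c
  Mat A k = Fin k → Fin k → A

  -- 𝔐(F, t, n, k), where t e stands for the e-th power of the variable
  -- (t = Tpow for T, t = Tpow ∘ ℤ.-_ for T⁻¹, i.e. T replaced by T⁻¹).
  𝔐gen : ∀ {m} → (q : ℕ) → Poly m → (ℤ → LP) → ℕ → (k : ℕ) → Mat LP k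
  𝔐gen q F t n k i j =
    ΣLP n λ l → (sgn l * ⟦ n C l ⟧ *
      coeff F (+ (suc (toℕ i) ℕ.* q) ℤ.- + suc (toℕ j) ℤ.- + l)) • t (+ (n ∸ l))

  𝔐 : ∀ {m} → (q : ℕ) → Poly m → ℕ → (k : ℕ) → Mat LP k
  𝔐 q F n k = 𝔐gen q F Tpow n k

  𝔐inv : ∀ {m} → (q : ℕ) → Poly m → ℕ → (k : ℕ) → Mat LP k
  𝔐inv q F n k = 𝔐gen q F (λ e → Tpow (ℤ.- e)) n k

  _≈M_ : ∀ {k} → Mat Carrier k → Mat Carrier k → Set ℓ
  A ≈M B = ∀ i j → A i j ≈ B i j

  _*M_ : ∀ {k} → Mat Carrier k → Mat Carrier k → Mat Carrier k
  _*M_ {k} A B i j = sumC k (λ r → A i r * B r j)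
    where
      sumC : (k' : ℕ) → (Fin k' → Carrier) → Carrier
      sumC zero    f = 0#
      sumC (suc k') f = f Fin.zero + sumC k' (λ r → f (Fin.suc r))

  I : ∀ {k} → Mat Carrier k
  I i j with i ≟F j
  ... | yes _ = 1#
  ... | no _  = 0#

  W₃ : ∀ {k} → Mat Carrier k
  W₃ i j with j ≟F opposite i
  ... | yes _ = 1#
  ... | no _  = 0#

  _⊛_ : ∀ {k} → Mat Carrier k → Mat LP k → Mat LP k
  (A ⊛ M) i j = ΣFin λ r → A i r • M r j

  _⊛ʳ_ : ∀ {k} → Mat LP k → Mat Carrier k → Mat LP k
  (M ⊛ʳ B) i j = ΣFin λ r → B r j • M i r

  _≈MLP_ : ∀ {k} → Mat LP k → Mat LP k → Set ℓ
  M ≈MLP N = ∀ i j → M i j ≈LP N i j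

  negTpow· : ∀ {k} → ℕ → Mat LP k → Mat LP k
  negTpow· n M i j = mulMono (sgn n) (+ n) (M i j)

-- Conjugation by the antidiagonal W₃, which is its own inverse, reverses both
-- indices, so the claim is entrywise: 𝔐(P,T)_{k+1-i,k+1-j} = (-T)^n 𝔐(ι P,T⁻¹)_{i,j}.
-- In degree t the left side picks the term l = n - t of its sum and the right side
-- the term l = t; the binomials agree, the signs differ by (-1)^n, and the two
-- subscripts of b add up to (k+1)(q-1) - n = m, which is exactly the reflection
-- b_y ↦ b_{m-y} defining ι(P). Only the relation (k+1)(q-1) = m + n is used, over
-- any commutative ring; n ≥ 1 merely rules out q = 0.

module Submission where

open import Defs
open import Algebra.Bundles using (CommutativeRing)
open import Data.Fin as Fin using (Fin; toℕ; opposite; fromℕ<)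
open import Data.Fin.Properties as Finₚ using (opposite-involutive; opposite-prop; toℕ<n)
open import Data.Integer as ℤ using (ℤ; +_; -[1+_])
open import Data.Integer.Properties as ℤₚ using (+-injective)
import Data.Integer.Tactic.RingSolver as ℤ-Solver
open import Data.Product using (∃; _×_; _,_)
open import Data.Sum using (_⊎_; inj₁; inj₂)
open import Function using (_∘_)
open import Relation.Nullary using (yes; no; contradiction)
open import Relation.Binary.PropositionalEquality
  using (_≡_; _≢_; refl; cong; cong₂; subst; module ≡-Reasoning)
  renaming (sym to ≡-sym; trans to ≡-trans)

module IndexArithmetic where
  open import Data.Nat using (ℕ; suc; _+_; _*_; _∸_; _≤_; _<_; s≤s; z≤n)
  open import Data.Nat.Properties
  open import Algebra.Properties.CommutativeSemigroup +-commutativeSemigroup using (x∙yz≈y∙xz)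
  open ≡-Reasoning

  opposite-sym : ∀ {k} {i j : Fin k} → i ≡ opposite j → j ≡ opposite i
  opposite-sym {j = j} refl = ≡-sym (opposite-involutive j)

  entryIndex : ∀ {k} → ℕ → Fin k → Fin k → ℕ → ℤ
  entryIndex q i j l = + (suc (toℕ i) * q) ℤ.- + suc (toℕ j) ℤ.- + l

  suc-opposite+suc : ∀ {k} (i : Fin k) → suc (toℕ (opposite i)) + suc (toℕ i) ≡ suc k
  suc-opposite+suc {k} i = begin
    suc (toℕ (opposite i) + suc (toℕ i)) ≡⟨ cong (λ x → suc (x + suc (toℕ i))) (opposite-prop i) ⟩
    suc (k ∸ suc (toℕ i) + suc (toℕ i))  ≡⟨ cong suc (m∸n+n≡m (toℕ<n i)) ⟩
    suc k                                ∎

  regroup : ∀ x y u v s t →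
    (x ℤ.- u ℤ.- s) ℤ.+ (y ℤ.- v ℤ.- t) ≡ (x ℤ.+ y) ℤ.- (u ℤ.+ v ℤ.+ (s ℤ.+ t))
  regroup = ℤ-Solver.solve-∀

  add-sub-cancel : ∀ x y → x ℤ.+ y ℤ.- y ≡ x
  add-sub-cancel = ℤ-Solver.solve-∀

  sub-add-cancel : ∀ x y → x ≡ x ℤ.- y ℤ.+ y
  sub-add-cancel = ℤ-Solver.solve-∀

  subscripts-sum : ∀ {x y u v s t m} → x + y ≡ m + (u + v + (s + t)) →
    (+ x ℤ.- + u ℤ.- + s) ℤ.+ (+ y ℤ.- + v ℤ.- + t) ≡ + m
  subscripts-sum {x} {y} {u} {v} {s} {t} {m} eq = begin
    (+ x ℤ.- + u ℤ.- + s) ℤ.+ (+ y ℤ.- + v ℤ.- + t) ≡⟨ regroup (+ x) (+ y) (+ u) (+ v) (+ s) (+ t) ⟩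
    + (x + y) ℤ.- + w                                ≡⟨ cong (λ z → + z ℤ.- + w) eq ⟩
    + m ℤ.+ + w ℤ.- + w                              ≡⟨ add-sub-cancel (+ m) (+ w) ⟩
    + m                                              ∎
    where w = u + v + (s + t)

  opposite-entryIndex-sum : ∀ {q m n k t} (i j : Fin k) → suc k * q ≡ m + n → t ≤ n →
    entryIndex (suc q) (opposite i) (opposite j) (n ∸ t) ℤ.+ entryIndex (suc q) i j t ≡ + m
  opposite-entryIndex-sum {q} {m} {n} {k} {t} i j h t≤n =
    subscripts-sum {suc ī * suc q} {suc i′ * suc q} {suc j̄} {suc j′} {n ∸ t} (begin
    suc ī * suc q + suc i′ * suc q ≡⟨ *-distribʳ-+ (suc q) (suc ī) (suc i′) ⟨
    (suc ī + suc i′) * suc q       ≡⟨ cong (_* suc q) (suc-opposite+suc i) ⟩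
    suc k * suc q                  ≡⟨ *-suc (suc k) q ⟩
    suc k + suc k * q              ≡⟨ cong (λ x → suc k + x) h ⟩
    suc k + (m + n)                ≡⟨ x∙yz≈y∙xz (suc k) m n ⟩
    m + (suc k + n)                ≡⟨ cong₂ (λ a b → m + (a + b)) (suc-opposite+suc j) (m∸n+n≡m t≤n) ⟨
    m + (suc j̄ + suc j′ + (n ∸ t + t)) ∎)
    where
      ī = toℕ (opposite i)
      i′ = toℕ i
      j̄ = toℕ (opposite j)
      j′ = toℕ j

  toℕ-opposite-fromℕ< : ∀ {r s m} (s<1+m : s < suc m) → r + s ≡ m → toℕ (opposite (fromℕ< s<1+m)) ≡ r
  toℕ-opposite-fromℕ< {r} {s} {m} s<1+m r+s≡m = begin
    toℕ (opposite (fromℕ< s<1+m)) ≡⟨ opposite-prop (fromℕ< s<1+m) ⟩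
    m ∸ toℕ (fromℕ< s<1+m)        ≡⟨ cong (m ∸_) (Finₚ.toℕ-fromℕ< s<1+m) ⟩
    m ∸ s                         ≡⟨ cong (_∸ s) r+s≡m ⟨
    r + s ∸ s                     ≡⟨ m+n∸n≡m r s ⟩
    r                             ∎

  degree-cases : ∀ n d → (∃ λ t → t ≤ n × d ≡ + t) ⊎ (∀ l → l ≤ n → d ≢ + l)
  degree-cases n (+ t) with t ≤? n
  ... | yes t≤n = inj₁ (t , t≤n , refl)
  ... | no t≰n  = inj₂ λ { l l≤n refl → t≰n l≤n }
  degree-cases n -[1+ t ] = inj₂ λ _ _ ()

  neg-∸-shift : ∀ {l n} → l ≤ n → ℤ.- + (n ∸ l) ≡ + l ℤ.- + n
  neg-∸-shift {l} {n} l≤n = ≡-trans (≡-sym (ℤₚ.⊖-≤ l≤n)) (≡-sym (ℤₚ.m-n≡m⊖n l n))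

  neg-∸-shift-injective : ∀ {l n d} → l ≤ n → ℤ.- + (n ∸ l) ≡ d ℤ.- + n → d ≡ + l
  neg-∸-shift-injective {l} {n} {d} l≤n eq = begin
    d                    ≡⟨ sub-add-cancel d (+ n) ⟩
    d ℤ.- + n ℤ.+ + n    ≡⟨ cong (ℤ._+ + n) (≡-trans (≡-sym eq) (neg-∸-shift l≤n)) ⟩
    + l ℤ.- + n ℤ.+ + n  ≡⟨ sub-add-cancel (+ l) (+ n) ⟨
    + l                  ∎

  sum-with-negative : ∀ r s {m} → + r ℤ.+ -[1+ s ] ≡ + m → m < r
  sum-with-negative r s {m} eq = subst (m <_) (≡-sym r≡m+1+s) (m<m+n m (s≤s z≤n))
    where
      r≡m+1+s : r ≡ m + suc s
      r≡m+1+s = +-injective (≡-trans (≡-sym (add-sub-cancel (+ r) -[1+ s ])) (cong (ℤ._- -[1+ s ]) eq))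

open IndexArithmetic

module _ {c ℓ} (F : CommutativeRing c ℓ) where
  open CommutativeRing F renaming (refl to ≈-refl)
  open import Algebra.Properties.Ring ring using (-‿distribˡ-*; -‿distribʳ-*; -‿involutive)
  open import Algebra.Properties.CommutativeMonoid.Sum +-commutativeMonoid
    using (sum; sum-remove; sum-cong-≋; sum-replicate-zero)
  open import Data.Nat as ℕ using (ℕ; suc; zero; _∸_; _≤_; _<_; z≤n)
  open import Data.Nat.Properties as ℕₚ using (m≤n⇒m≤1+n; ≤-refl; m∸n≤m; m∸[m∸n]≡n; m∸n+n≡m)
  open import Data.Vec.Functional using (removeAt; replicate)
  open import Data.Nat.Combinatorics using (_C_; nCk≡nC[n∸k])
  open import Relation.Binary.Reasoning.Setoid setoid

  sum-select : ∀ {k} (f : Fin k → Carrier) (t : Fin k) → (∀ s → s ≢ t → f s ≈ 0#) → sum f ≈ f t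
  sum-select {suc k} f t f≈0 = begin
    sum f                      ≈⟨ sum-remove f ⟩
    f t + sum (removeAt f t)   ≈⟨ +-congˡ (sum-cong-≋ λ s → f≈0 _ (Finₚ.punchInᵢ≢i t s)) ⟩
    f t + sum (replicate k 0#) ≈⟨ +-congˡ (sum-replicate-zero k) ⟩
    f t + 0#                   ≈⟨ +-identityʳ _ ⟩
    f t                        ∎

  ΣFin-at : ∀ {k} (f : Fin k → LP F) d → ΣFin F f d ≡ sum (λ r → f r d)
  ΣFin-at {zero}  f d = refl
  ΣFin-at {suc k} f d = cong (λ x → f Fin.zero d + x) (ΣFin-at (f ∘ Fin.suc) d)

  *M-entry : ∀ {k} (A B : Mat F Carrier k) i j → _*M_ F A B i j ≡ sum (λ r → A i r * B r j)
  *M-entry {suc zero}    A B i j = refl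
  *M-entry {suc (suc k)} A B i j =
    cong (λ x → A i Fin.zero * B Fin.zero j + x) (*M-entry Aᵢ B⁼ⱼ Fin.zero Fin.zero)
    where
      Aᵢ B⁼ⱼ : Mat F Carrier (suc k)
      Aᵢ _ r = A i (Fin.suc r)
      B⁼ⱼ r _ = B (Fin.suc r) j

  W₃-antidiagonal : ∀ {k} (i : Fin k) → W₃ F i (opposite i) ≈ 1#
  W₃-antidiagonal i with opposite i Finₚ.≟ opposite i
  ... | yes _  = ≈-refl
  ... | no ī≢ī = contradiction refl ī≢ī

  W₃-off : ∀ {k} (i j : Fin k) → j ≢ opposite i → W₃ F i j ≈ 0#
  W₃-off i j j≢ī with j Finₚ.≟ opposite i
  ... | yes j≡ī = contradiction j≡ī j≢ī
  ... | no  _   = ≈-refl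

  W₃-symmetric : ∀ {k} (i j : Fin k) → W₃ F i j ≈ W₃ F j i
  W₃-symmetric i j with j Finₚ.≟ opposite i | i Finₚ.≟ opposite j
  ... | yes _   | yes _   = ≈-refl
  ... | no  _   | no  _   = ≈-refl
  ... | yes j≡ī | no  i≢j̄ = contradiction (opposite-sym j≡ī) i≢j̄
  ... | no  j≢ī | yes i≡j̄ = contradiction (opposite-sym i≡j̄) j≢ī

  I-opposite : ∀ {k} (r j : Fin k) → I F (opposite r) j ≈ W₃ F r j
  I-opposite r j with opposite r Finₚ.≟ j | j Finₚ.≟ opposite r
  ... | yes _   | yes _   = ≈-refl
  ... | no  _   | no  _   = ≈-refl
  ... | yes r̄≡j | no  j≢r̄ = contradiction (≡-sym r̄≡j) j≢r̄
  ... | no  r̄≢j | yes j≡r̄ = contradiction (≡-sym j≡r̄) r̄≢j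

  W₃-select : ∀ {k} (i : Fin k) (v : Fin k → Carrier) → sum (λ s → W₃ F i s * v s) ≈ v (opposite i)
  W₃-select i v = begin
    sum (λ s → W₃ F i s * v s)           ≈⟨ sum-select (λ s → W₃ F i s * v s) (opposite i) off ⟩
    W₃ F i (opposite i) * v (opposite i) ≈⟨ *-congʳ (W₃-antidiagonal i) ⟩
    1# * v (opposite i)                  ≈⟨ *-identityˡ _ ⟩
    v (opposite i)                       ∎
    where
      off : ∀ s → s ≢ opposite i → W₃ F i s * v s ≈ 0#
      off s s≢ī = trans (*-congʳ (W₃-off i s s≢ī)) (zeroˡ _)

  W₃-self-inverse : ∀ {k} (B : Mat F Carrier k) → _≈M_ F (_*M_ F (W₃ F) B) (I F) → _≈M_ F B (W₃ F)
  W₃-self-inverse B W₃B≈I r j = begin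
    B r j                                   ≡⟨ cong (λ s → B s j) (opposite-involutive r) ⟨
    B (opposite (opposite r)) j             ≈⟨ W₃-select (opposite r) (λ s → B s j) ⟨
    sum (λ s → W₃ F (opposite r) s * B s j) ≡⟨ *M-entry (W₃ F) B (opposite r) j ⟨
    _*M_ F (W₃ F) B (opposite r) j          ≈⟨ W₃B≈I (opposite r) j ⟩
    I F (opposite r) j                      ≈⟨ I-opposite r j ⟩
    W₃ F r j                                ∎

  W₃-conjugate : ∀ {k} (M : Mat F (LP F) k) (B : Mat F Carrier k) → _≈M_ F (_*M_ F (W₃ F) B) (I F) →
    _≈MLP_ F (_⊛ʳ_ F (_⊛_ F (W₃ F) M) B) (λ i j → M (opposite i) (opposite j))
  W₃-conjugate M B W₃B≈I i j d = begin
    _⊛ʳ_ F W₃M B i j d                        ≡⟨ ΣFin-at (λ r → _•_ F (B r j) (W₃M i r)) d ⟩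
    sum (λ r → B r j * W₃M i r d)             ≈⟨ sum-cong-≋ (λ r → *-congʳ (B≈W₃ r)) ⟩
    sum (λ r → W₃ F j r * W₃M i r d)          ≈⟨ W₃-select j (λ r → W₃M i r d) ⟩
    W₃M i (opposite j) d                      ≡⟨ ΣFin-at (λ s → _•_ F (W₃ F i s) (M s (opposite j))) d ⟩
    sum (λ s → W₃ F i s * M s (opposite j) d) ≈⟨ W₃-select i (λ s → M s (opposite j) d) ⟩
    M (opposite i) (opposite j) d             ∎
    where
      W₃M = _⊛_ F (W₃ F) M
      B≈W₃ : ∀ r → B r j ≈ W₃ F j r
      B≈W₃ r = trans (W₃-self-inverse B W₃B≈I r j) (W₃-symmetric r j)

  sgn-+ : ∀ a b → sgn F (a ℕ.+ b) ≈ sgn F a * sgn F b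
  sgn-+ zero    b = sym (*-identityˡ _)
  sgn-+ (suc a) b = trans (-‿cong (sgn-+ a b)) (-‿distribˡ-* _ _)

  sgn*sgn : ∀ a → sgn F a * sgn F a ≈ 1#
  sgn*sgn zero    = *-identityˡ 1#
  sgn*sgn (suc a) = begin
    - s * - s   ≈⟨ -‿distribˡ-* s (- s) ⟨
    - (s * - s) ≈⟨ -‿cong (-‿distribʳ-* s s) ⟨
    - - (s * s) ≈⟨ -‿involutive (s * s) ⟩
    s * s       ≈⟨ sgn*sgn a ⟩
    1#          ∎
    where s = sgn F a

  sgn-∸ : ∀ {n t} → t ≤ n → sgn F (n ∸ t) ≈ sgn F n * sgn F t
  sgn-∸ {n} {t} t≤n = begin
    sgn F (n ∸ t)                       ≈⟨ *-identityʳ _ ⟨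
    sgn F (n ∸ t) * 1#                  ≈⟨ *-congˡ (sgn*sgn t) ⟨
    sgn F (n ∸ t) * (sgn F t * sgn F t) ≈⟨ *-assoc _ _ _ ⟨
    sgn F (n ∸ t) * sgn F t * sgn F t   ≈⟨ *-congʳ (sgn-+ (n ∸ t) t) ⟨
    sgn F (n ∸ t ℕ.+ t) * sgn F t       ≡⟨ cong (λ x → sgn F x * sgn F t) (m∸n+n≡m t≤n) ⟩
    sgn F n * sgn F t                   ∎

  reflected-term : ∀ {n t b b′} → t ≤ n → b ≈ b′ →
    sgn F (n ∸ t) * ⟦_⟧ F (n C (n ∸ t)) * b ≈ sgn F n * (sgn F t * ⟦_⟧ F (n C t) * b′)
  reflected-term {n} {t} {b} {b′} t≤n b≈b′ = begin
    sgn F (n ∸ t) * ⟦_⟧ F (n C (n ∸ t)) * b ≈⟨ *-cong (*-cong (sgn-∸ t≤n) binomial) b≈b′ ⟩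
    sgn F n * sgn F t * ⟦_⟧ F (n C t) * b′  ≈⟨ *-congʳ (*-assoc _ _ _) ⟩
    sgn F n * (sgn F t * ⟦_⟧ F (n C t)) * b′ ≈⟨ *-assoc _ _ _ ⟩
    sgn F n * (sgn F t * ⟦_⟧ F (n C t) * b′) ∎
    where binomial = reflexive (cong (⟦_⟧ F) (≡-sym (nCk≡nC[n∸k] t≤n)))

  coeff-toℕ : ∀ {m} (P : Poly F m) (i : Fin (suc m)) → coeff F P (+ toℕ i) ≈ P i
  coeff-toℕ {m} P i with toℕ i ℕ.<? suc m
  ... | yes i<1+m = reflexive (cong P (Finₚ.toℕ-injective (Finₚ.toℕ-fromℕ< i<1+m)))
  ... | no  i≮1+m = contradiction (toℕ<n i) i≮1+m

  coeff-above : ∀ {m s} (P : Poly F m) → m < s → coeff F P (+ s) ≈ 0#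
  coeff-above {m} {s} P m<s with s ℕ.<? suc m
  ... | yes s<1+m = contradiction (ℕₚ.≤-pred s<1+m) (ℕₚ.<⇒≱ m<s)
  ... | no  _     = ≈-refl

  coeff-ι : ∀ {m} (P : Poly F m) x y → x ℤ.+ y ≡ + m → coeff F (ι F P) y ≈ coeff F P x
  coeff-ι {m} P (+ r) (+ s) +r+s≡m = begin
    coeff F (ι F P) (+ s)              ≡⟨ cong (λ x → coeff F (ι F P) (+ x)) (Finₚ.toℕ-fromℕ< s<1+m) ⟨
    coeff F (ι F P) (+ toℕ i)          ≈⟨ coeff-toℕ (ι F P) i ⟩
    P (opposite i)                     ≈⟨ coeff-toℕ P (opposite i) ⟨
    coeff F P (+ toℕ (opposite i))     ≡⟨ cong (λ x → coeff F P (+ x)) opposite-i≡r ⟩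
    coeff F P (+ r)                    ∎
    where
      r+s≡m : r ℕ.+ s ≡ m
      r+s≡m = +-injective +r+s≡m
      s<1+m : s < suc m
      s<1+m = ℕ.s≤s (subst (s ≤_) r+s≡m (ℕₚ.m≤n+m s r))
      i = fromℕ< s<1+m
      opposite-i≡r = toℕ-opposite-fromℕ< s<1+m r+s≡m
  coeff-ι P (+ r) -[1+ s ] eq = sym (coeff-above P (sum-with-negative r s eq))
  coeff-ι P -[1+ r ] (+ s) eq =
    coeff-above (ι F P) (sum-with-negative s r (≡-trans (ℤₚ.+-comm (+ s) -[1+ r ]) eq))
  coeff-ι P -[1+ r ] -[1+ s ] ()

  Tpow-at : ∀ {e d} → d ≡ e → Tpow F e d ≈ 1#
  Tpow-at {e} {d} d≡e with d ℤ.≟ e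
  ... | yes _   = ≈-refl
  ... | no  d≢e = contradiction d≡e d≢e

  Tpow-off : ∀ {e d} → d ≢ e → Tpow F e d ≈ 0#
  Tpow-off {e} {d} d≢e with d ℤ.≟ e
  ... | yes d≡e = contradiction d≡e d≢e
  ... | no  _   = ≈-refl

  ΣLP-vanishes : ∀ n (f : ℕ → LP F) d → (∀ l → l ≤ n → f l d ≈ 0#) → ΣLP F n f d ≈ 0#
  ΣLP-vanishes zero    f d f≈0 = f≈0 0 z≤n
  ΣLP-vanishes (suc n) f d f≈0 =
    trans (+-cong (ΣLP-vanishes n f d (λ l l≤n → f≈0 l (m≤n⇒m≤1+n l≤n))) (f≈0 (suc n) ≤-refl))
          (+-identityʳ 0#)

  ΣLP-select : ∀ n (f : ℕ → LP F) d {l₀} → l₀ ≤ n →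
    (∀ l → l ≤ n → l ≢ l₀ → f l d ≈ 0#) → ΣLP F n f d ≈ f l₀ d
  ΣLP-select zero    f d z≤n  _   = ≈-refl
  ΣLP-select (suc n) f d l₀≤1+n f≈0 with ℕₚ.m≤n⇒m<n∨m≡n l₀≤1+n
  ... | inj₁ l₀<1+n =
    trans (+-cong (ΣLP-select n f d (ℕₚ.≤-pred l₀<1+n) (λ l l≤n → f≈0 l (m≤n⇒m≤1+n l≤n)))
                  (f≈0 (suc n) ≤-refl (λ 1+n≡l₀ → ℕₚ.<-irrefl (≡-sym 1+n≡l₀) l₀<1+n)))
          (+-identityʳ _)
  ... | inj₂ refl =
    trans (+-cong (ΣLP-vanishes n f d (λ l l≤n → f≈0 l (m≤n⇒m≤1+n l≤n) (ℕₚ.<⇒≢ (ℕ.s≤s l≤n)))) ≈-refl)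
          (+-identityˡ _)

  monomials-coefficient : ∀ n (a : ℕ → Carrier) (e : ℕ → ℤ) {d l₀} → l₀ ≤ n → d ≡ e l₀ →
    (∀ l → l ≤ n → d ≡ e l → l ≡ l₀) → ΣLP F n (λ l → _•_ F (a l) (Tpow F (e l))) d ≈ a l₀
  monomials-coefficient n a e {d} {l₀} l₀≤n d≡eₗ₀ unique = begin
    ΣLP F n (λ l → _•_ F (a l) (Tpow F (e l))) d ≈⟨ ΣLP-select n _ d l₀≤n miss ⟩
    a l₀ * Tpow F (e l₀) d                       ≈⟨ *-congˡ (Tpow-at d≡eₗ₀) ⟩
    a l₀ * 1#                                    ≈⟨ *-identityʳ _ ⟩
    a l₀                                         ∎
    where
      miss : ∀ l → l ≤ n → l ≢ l₀ → a l * Tpow F (e l) d ≈ 0#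
      miss l l≤n l≢l₀ = trans (*-congˡ (Tpow-off (l≢l₀ ∘ unique l l≤n))) (zeroʳ _)

  monomials-vanish : ∀ n (a : ℕ → Carrier) (e : ℕ → ℤ) {d} → (∀ l → l ≤ n → d ≢ e l) →
    ΣLP F n (λ l → _•_ F (a l) (Tpow F (e l))) d ≈ 0#
  monomials-vanish n a e {d} miss =
    ΣLP-vanishes n _ d (λ l l≤n → trans (*-congˡ (Tpow-off (miss l l≤n))) (zeroʳ _))

  𝔐-term : ∀ {m k} → ℕ → Poly F m → ℕ → Fin k → Fin k → ℕ → Carrier
  𝔐-term q P n i j l = sgn F l * ⟦_⟧ F (n C l) * coeff F P (entryIndex q i j l)

  module _ {m} (q : ℕ) (P : Poly F m) (n k : ℕ) (i j : Fin k) where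

    𝔐-coefficient : ∀ {t} → t ≤ n → 𝔐 F q P n k i j (+ t) ≈ 𝔐-term q P n i j (n ∸ t)
    𝔐-coefficient {t} t≤n =
      monomials-coefficient n _ _ (m∸n≤m n t) (cong +_ (≡-sym (m∸[m∸n]≡n t≤n))) unique
      where
        unique : ∀ l → l ≤ n → + t ≡ + (n ∸ l) → l ≡ n ∸ t
        unique l l≤n t≡n∸l = ≡-trans (≡-sym (m∸[m∸n]≡n l≤n)) (cong (n ∸_) (≡-sym (+-injective t≡n∸l)))

    𝔐-vanishes : ∀ {d} → (∀ l → l ≤ n → d ≢ + l) → 𝔐 F q P n k i j d ≈ 0#
    𝔐-vanishes outside = monomials-vanish n _ _ (λ l _ → outside (n ∸ l) (m∸n≤m n l))

    𝔐inv-coefficient : ∀ {t} → t ≤ n → 𝔐inv F q P n k i j (+ t ℤ.- + n) ≈ 𝔐-term q P n i j t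
    𝔐inv-coefficient t≤n =
      monomials-coefficient n _ _ t≤n (≡-sym (neg-∸-shift t≤n))
        (λ l l≤n eq → ≡-sym (+-injective (neg-∸-shift-injective l≤n (≡-sym eq))))

    𝔐inv-vanishes : ∀ {d} → (∀ l → l ≤ n → d ≢ + l) → 𝔐inv F q P n k i j (d ℤ.- + n) ≈ 0#
    𝔐inv-vanishes outside =
      monomials-vanish n _ _ (λ l l≤n eq → outside l l≤n (neg-∸-shift-injective l≤n (≡-sym eq)))

  𝔐-opposite-entry : ∀ {q m n k} → suc k ℕ.* q ≡ m ℕ.+ n → (P : Poly F m) (i j : Fin k) (d : ℤ) →
    𝔐 F (suc q) P n k (opposite i) (opposite j) d ≈ sgn F n * 𝔐inv F (suc q) (ι F P) n k i j (d ℤ.- + n)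
  𝔐-opposite-entry {q} {m} {n} {k} h P i j d with degree-cases n d
  ... | inj₁ (t , t≤n , refl) = begin
    𝔐 F (suc q) P n k (opposite i) (opposite j) (+ t)
      ≈⟨ 𝔐-coefficient (suc q) P n k (opposite i) (opposite j) t≤n ⟩
    𝔐-term (suc q) P n (opposite i) (opposite j) (n ∸ t)
      ≈⟨ reflected-term t≤n (sym (coeff-ι P x y x+y≡m)) ⟩
    sgn F n * 𝔐-term (suc q) (ι F P) n i j t
      ≈⟨ *-congˡ (𝔐inv-coefficient (suc q) (ι F P) n k i j t≤n) ⟨
    sgn F n * 𝔐inv F (suc q) (ι F P) n k i j (+ t ℤ.- + n)
      ∎
    where
      x = entryIndex (suc q) (opposite i) (opposite j) (n ∸ t)
      y = entryIndex (suc q) i j t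
      x+y≡m = opposite-entryIndex-sum i j h t≤n
  ... | inj₂ outside = begin
    𝔐 F (suc q) P n k (opposite i) (opposite j) d
      ≈⟨ 𝔐-vanishes (suc q) P n k (opposite i) (opposite j) outside ⟩
    0#
      ≈⟨ zeroʳ _ ⟨
    sgn F n * 0#
      ≈⟨ *-congˡ (𝔐inv-vanishes (suc q) (ι F P) n k i j outside) ⟨
    sgn F n * 𝔐inv F (suc q) (ι F P) n k i j (d ℤ.- + n)
      ∎

open import Data.Nat using (ℕ; zero; suc; _∸_; _*_; _+_; _≤_)
open import Data.Nat.Properties using (*-zeroʳ; m+1+n≢0)

mainTheorem8 : ∀ {c ℓ} (F : CommutativeRing c ℓ) (q : ℕ) → IsPrimePower q → IsField F → HasCard F q →
    (n m k : ℕ) → 1 ≤ n → suc k * (q ∸ 1) ≡ m + n → 1 ≤ k →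
    (P : Poly F m) → (W₃⁻¹ : Mat F (CommutativeRing.Carrier F) k) →
    _≈M_ F (_*M_ F (W₃ F) W₃⁻¹) (I F) → _≈M_ F (_*M_ F W₃⁻¹ (W₃ F)) (I F) →
    _≈MLP_ F (_⊛ʳ_ F (_⊛_ F (W₃ F) (𝔐 F q P n k)) W₃⁻¹)
      (negTpow· F n (𝔐inv F q (ι F P) n k))
mainTheorem8 F zero _ _ _ (suc n) m k _ h _ _ _ _ _ =
  contradiction (≡-trans (≡-sym h) (*-zeroʳ (suc k))) (m+1+n≢0 m)
mainTheorem8 F (suc q) _ _ _ n m k _ h _ P W₃⁻¹ W₃W₃⁻¹≈I _ i j d =
  trans (W₃-conjugate F (𝔐 F (suc q) P n k) W₃⁻¹ W₃W₃⁻¹≈I i j d) (𝔐-opposite-entry F h P i j d)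
  where open CommutativeRing F using (trans)
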